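{- Let $k\ge2$ and $t$ be positive integers such that every integer in $[1,2k-1]$ divides $t$, and let $I_k=\{i\in\mathbb{Z}:-k\le i\le k\}$. Let $S$ be a zero-sum sequence over $I_k$ with $|S|\ge t+k(k-1)$ that contains no zero-sum subsequence of length $t$, and let $S=S_1\cdot\ldots\cdot S_h$ be a factorization of $S$ into minimal zero-sum subsequences. Let $L=\{|S_i|: 1\le i\le h\}$, $\alpha=\max_{\ell\in L}\ell$, and for $\ell\in L$ let $n_\ell$ be the number of indices $i\in[1,h]$ with $|S_i|=\ell$. If there exists $\beta\in L$ with $n_\beta\ge\alpha-1$, then \[|S|\le t-\beta+(\beta-1)\max_{\ell\in L\setminus\{\beta\}}\ell,\] where the maximum over the empty set is taken to be $0$.
   Context: A sequence over $I_k$ is a finite unordered list of elements of $I_k$ with repetition allowed; $|S|$ is its length; a subsequence is a sub-multiset; a sequence is zero-sum if its sum is $0$; a zero-sum sequence is minimal if it is nonempty and has no proper nonempty zero-sum subsequence. A factorization $S=S_1\cdots S_h$ means $S$ is the concatenation of the $S_i$. -}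

module Defs where

open import Data.Nat as ℕ using (ℕ; _⊔_; _≟_)
open import Data.Integer as ℤ using (ℤ; _≤_; -_; +_)
open import Data.List using (List; []; _++_; length; filter; foldr; map; concat)
open import Data.List.Relation.Unary.All using (All)
open import Data.List.Relation.Binary.Permutation.Propositional using (_↭_)
open import Data.Product using (∃; _×_)
open import Relation.Binary.PropositionalEquality using (_≡_; _≢_)
open import Relation.Nullary using (¬_; ¬?)

-- A sequence over ℤ is a list (order irrelevant: we work up to permutation _↭_).
Seq : Set
Seq = List ℤ

OverIk : ℕ → Seq → Set
OverIk k S = All (λ x → (- (+ k)) ≤ x × x ≤ (+ k)) S

SubSeq : Seq → Seq → Set
SubSeq T S = ∃ λ R → (T ++ R) ↭ S

sumℤ : Seq → ℤ
sumℤ = foldr ℤ._+_ (+ 0)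

ZeroSum : Seq → Set
ZeroSum S = sumℤ S ≡ + 0

MinimalZeroSum : Seq → Set
MinimalZeroSum U =
  U ≢ [] × ZeroSum U ×
  (∀ T → SubSeq T U → T ≢ [] → ZeroSum T → length T ≡ length U)

Factorization : Seq → List Seq → Set
Factorization S Fs = (concat Fs ↭ S) × All MinimalZeroSum Fs

maxL : List ℕ → ℕ
maxL = foldr _⊔_ 0

countL : ℕ → List ℕ → ℕ
countL ℓ L = length (filter (λ m → m ≟ ℓ) L)

removeL : ℕ → List ℕ → List ℕ
removeL β L = filter (λ m → ¬? (m ≟ β)) L

-- A minimal zero-sum sequence over I_k has length at most 2k − 1: either it is [0] or [k, −k], or
-- one of ±k is missing and its terms can be ordered so that all partial sums stay in a window of
-- 2k − 1 integers, where two equal partial sums would cut out a shorter zero-sum block.  So β ∣ t,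
-- say t = mβ.  Pigeonholing prefix sums modulo β groups the factors of length ≠ β into blocks of at
-- most β factors, each of total length qβ with q ≤ α, plus fewer than β leftover factors.  If |S| + β
-- exceeded the bound, the blocks and the length-β factors would have total length at least mβ; taking
-- blocks greedily and topping up with at most α − 1 factors of length β then yields factors of total
-- length exactly t, i.e. a zero-sum subsequence of length t.

module Submission where

open import Defs
open import Data.Nat using (ℕ; _≤_; _+_; _*_; _∸_)
open import Data.Nat.Divisibility using (_∣_)
open import Data.List using (List; length; map)
open import Data.List.Membership.Propositional using (_∈_)
open import Data.Product using (Σ; _×_)
open import Relation.Binary.PropositionalEquality using (_≡_)
open import Relation.Nullary using (¬_)

open import Algebra.Bundles using (AbelianGroup)
open import Data.Fin using (toℕ; fromℕ<)
open import Data.Fin.Properties using (pigeonhole; toℕ≤pred[n]; fromℕ<-injective)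
open import Data.Integer as ℤ using (ℤ; +_; -[1+_]; 0ℤ; -_; ∣_∣; +≤+)
  renaming (_+_ to _+ℤ_; _≤_ to _≤ℤ_; _<_ to _<ℤ_; _≤?_ to _≤ℤ?_; _<?_ to _<ℤ?_)
import Data.Integer.Properties as ℤₚ
open import Data.List using ([]; _∷_; _++_; take; drop; concat; filter)
open import Data.List.Properties
  using (length-map; length-take; length-drop; length-++; take-take; take++drop≡id; map-++; ++-assoc;
         concat-++; partition-defn; foldr-preservesᵇ)
open import Data.List.Membership.Propositional using (find)
open import Data.List.Membership.Propositional.Properties using (∈-∃++; ∈-map⁻)
open import Data.List.Membership.DecPropositional ℤ._≟_ using (_∈?_)
open import Data.List.Relation.Unary.All as All using (All; []; _∷_)
open import Data.List.Relation.Unary.All.Properties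
  using (take⁺; all-filter; filter⁺; concat⁻; ++⁻ˡ; ++⁻ʳ; ¬Any⇒All¬)
open import Data.List.Relation.Unary.Any using (Any; here; there; any?)
open import Data.List.Relation.Binary.Permutation.Propositional
  using (_↭_; ↭ₛ⇒↭; ↭⇒↭ₛ; ↭-refl; ↭-prep; ↭-sym; ↭-trans; ↭-reflexive; module PermutationReasoning)
open import Data.List.Relation.Binary.Permutation.Propositional.Properties
  using (shift; shifts; ++⁺ˡ; ++⁺ʳ; ++-comm; map⁺; ↭-length; All-resp-↭; ∈-resp-↭)
import Data.List.Relation.Binary.Permutation.Setoid.Properties as ↭ₛ
open import Data.Nat using (zero; suc; _<_; _⊓_; _<?_; _≤?_; _≟_; NonZero; >-nonZero; >-nonZero⁻¹; z≤n; s≤s; s≤s⁻¹)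
open import Data.Nat.Properties
open import Data.Nat.DivMod using (_%_; _/_; m≡m%n+[m/n]*n; m%n<n)
open import Data.Nat.Divisibility using (divides; ∣m+n∣m⇒∣n; ∣m∣n⇒∣m+n; n∣m*n)
open import Data.Nat.ListAction using (sum)
open import Data.Nat.ListAction.Properties using (sum-++; sum-↭)
open import Data.Product using (∃; ∃₂; _,_; proj₁; proj₂)
open import Data.Sum using (_⊎_; inj₁; inj₂)
open import Function using (_∘_)
open import Relation.Binary.PropositionalEquality
  using (refl; sym; trans; cong; cong₂; subst; subst₂; _≢_; setoid; module ≡-Reasoning)
open import Relation.Nullary using (yes; no; ¬?; contradiction)
open import Relation.Unary using (Decidable)

open import Algebra.Properties.Group (AbelianGroup.group ℤₚ.+-0-abelianGroup) using (∙-cancelˡ)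

infix 4 _⊆ₘ_
_⊆ₘ_ : {A : Set} → List A → List A → Set
ys ⊆ₘ xs = ∃ λ zs → ys ++ zs ↭ xs

module _ {A : Set} where

  ∈⇒↭∷ : {x : A} {xs : List A} → x ∈ xs → ∃ λ ys → xs ↭ x ∷ ys
  ∈⇒↭∷ {x} x∈xs with ys , zs , refl ← ∈-∃++ x∈xs = ys ++ zs , shift x ys zs

  concat⁺ : {xss yss : List (List A)} → xss ↭ yss → concat xss ↭ concat yss
  concat⁺ _↭_.refl = ↭-refl
  concat⁺ (_↭_.prep xs p) = ++⁺ˡ xs (concat⁺ p)
  concat⁺ (_↭_.swap xs ys p) = ↭-trans (shifts xs ys) (++⁺ˡ ys (++⁺ˡ xs (concat⁺ p)))
  concat⁺ (_↭_.trans p q) = ↭-trans (concat⁺ p) (concat⁺ q)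

  filter-partition-↭ : ∀ {P : A → Set} (P? : Decidable P) xs → xs ↭ filter P? xs ++ filter (¬? ∘ P?) xs
  filter-partition-↭ P? xs =
    subst (λ (ys , zs) → xs ↭ ys ++ zs) (partition-defn P? xs) (↭ₛ⇒↭ (↭ₛ.partition-↭ (setoid A) P? xs))

  ↭-++-length< : {xs ys zs : List A} → xs ↭ ys ++ zs → 1 ≤ length ys → length zs < length xs
  ↭-++-length< {xs} {ys} {zs} xs↭ys++zs 1≤ys = begin
    1 + length zs         ≤⟨ +-monoˡ-≤ (length zs) 1≤ys ⟩
    length ys + length zs ≡⟨ length-++ ys ⟨
    length (ys ++ zs)     ≡⟨ ↭-length {xs = xs} {ys = ys ++ zs} xs↭ys++zs ⟨
    length xs             ∎
    where open ≤-Reasoning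

  ⊆ₘ-trans : {xs ys zs : List A} → xs ⊆ₘ ys → ys ⊆ₘ zs → xs ⊆ₘ zs
  ⊆ₘ-trans {xs} {ys} {zs} (us , xs++us↭ys) (vs , ys++vs↭zs) = us ++ vs , (begin
    xs ++ us ++ vs    ≡⟨ ++-assoc xs us vs ⟨
    (xs ++ us) ++ vs  ↭⟨ ++⁺ʳ vs xs++us↭ys ⟩
    ys ++ vs          ↭⟨ ys++vs↭zs ⟩
    zs                ∎)
    where open PermutationReasoning

  ⊆ₘ-respʳ-↭ : {xs ys zs : List A} → xs ⊆ₘ ys → ys ↭ zs → xs ⊆ₘ zs
  ⊆ₘ-respʳ-↭ (us , xs++us↭ys) ys↭zs = us , ↭-trans xs++us↭ys ys↭zs

  All-⊆ₘ : ∀ {P : A → Set} {xs ys} → xs ⊆ₘ ys → All P ys → All P xs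
  All-⊆ₘ {xs = xs} (_ , xs++us↭ys) Pys = ++⁻ˡ xs (All-resp-↭ (↭-sym xs++us↭ys) Pys)

  singleton-⊆ₘ : ∀ {x xs} → x ∈ xs → x ∷ [] ⊆ₘ xs
  singleton-⊆ₘ x∈xs = let ys , xs↭x∷ys = ∈⇒↭∷ x∈xs in ys , ↭-sym xs↭x∷ys

  pair-⊆ₘ : ∀ {x y xs} → x ∈ xs → y ∈ xs → x ≢ y → x ∷ y ∷ [] ⊆ₘ xs
  pair-⊆ₘ {x} x∈xs y∈xs x≢y with ys , xs↭x∷ys ← ∈⇒↭∷ x∈xs with ∈-resp-↭ xs↭x∷ys y∈xs
  ... | here y≡x = contradiction (sym y≡x) x≢y
  ... | there y∈ys with zs , ys↭y∷zs ← ∈⇒↭∷ y∈ys = zs , ↭-sym (↭-trans xs↭x∷ys (↭-prep x ys↭y∷zs))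

  concat-⊆ₘ : {xss yss : List (List A)} → xss ⊆ₘ yss → concat xss ⊆ₘ concat yss
  concat-⊆ₘ {xss} (zss , xss++zss↭yss) = concat zss , ↭-trans (↭-reflexive (concat-++ xss zss)) (concat⁺ xss++zss↭yss)

  length-concat : (xss : List (List A)) → length (concat xss) ≡ sum (map length xss)
  length-concat [] = refl
  length-concat (xs ∷ xss) = trans (length-++ xs) (cong (λ n → length xs + n) (length-concat xss))

  slice : ℕ → ℕ → List A → List A
  slice i j xs = drop i (take j xs)

  take≡take++slice : ∀ {i j} xs → i ≤ j → take j xs ≡ take i xs ++ slice i j xs
  take≡take++slice {i} {j} xs i≤j = begin
    take j xs                           ≡⟨ take++drop≡id i (take j xs) ⟨
    take i (take j xs) ++ slice i j xs  ≡⟨ cong (_++ slice i j xs) (take-take i j xs) ⟩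
    take (i ⊓ j) xs ++ slice i j xs     ≡⟨ cong (λ n → take n xs ++ slice i j xs) (m≤n⇒m⊓n≡m i≤j) ⟩
    take i xs ++ slice i j xs           ∎
    where open ≡-Reasoning

  slice-↭ : ∀ {i j} xs → i ≤ j → slice i j xs ++ take i xs ++ drop j xs ↭ xs
  slice-↭ {i} {j} xs i≤j = begin
    slice i j xs ++ take i xs ++ drop j xs    ↭⟨ shifts (slice i j xs) (take i xs) ⟩
    take i xs ++ slice i j xs ++ drop j xs    ≡⟨ ++-assoc (take i xs) _ _ ⟨
    (take i xs ++ slice i j xs) ++ drop j xs  ≡⟨ cong (_++ drop j xs) (take≡take++slice xs i≤j) ⟨
    take j xs ++ drop j xs                    ≡⟨ take++drop≡id j xs ⟩
    xs                                        ∎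
    where open PermutationReasoning

  length-slice : ∀ i {j} xs → j ≤ length xs → length (slice i j xs) ≡ j ∸ i
  length-slice i {j} xs j≤ =
    trans (length-drop i (take j xs)) (cong (_∸ i) (trans (length-take j xs) (m≤n⇒m⊓n≡m j≤)))

  prefix-collision : ∀ m (c : List A → ℕ) xs → (∀ i → c (take i xs) < m) →
    ∃₂ λ i j → i < j × j ≤ m × c (take i xs) ≡ c (take j xs)
  prefix-collision m c xs c< with i , j , i<j , eq ← pigeonhole (n<1+n m) (λ i → fromℕ< (c< (toℕ i))) =
    toℕ i , toℕ j , i<j , toℕ≤pred[n] j , fromℕ<-injective _ _ (c< (toℕ i)) (c< (toℕ j)) eq

%-≡⇒∣ : ∀ m n d .{{_ : NonZero d}} → m % d ≡ (m + n) % d → d ∣ n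
%-≡⇒∣ m n d eq = ∣m+n∣m⇒∣n (divides ((m + n) / d) m/d*d+n≡) (n∣m*n (m / d))
  where
  open ≡-Reasoning
  m/d*d+n≡ : m / d * d + n ≡ (m + n) / d * d
  m/d*d+n≡ = +-cancelˡ-≡ (m % d) _ _ (begin
    m % d + (m / d * d + n)    ≡⟨ +-assoc (m % d) _ n ⟨
    m % d + m / d * d + n      ≡⟨ cong (_+ n) (m≡m%n+[m/n]*n m d) ⟨
    m + n                      ≡⟨ m≡m%n+[m/n]*n (m + n) d ⟩
    (m + n) % d + (m + n) / d * d  ≡⟨ cong (_+ (m + n) / d * d) eq ⟨
    m % d + (m + n) / d * d    ∎)

quotient-≤ : ∀ β .{{_ : NonZero β}} m n r s → r ≤ s → m * β + s < n * β + r + β → m ≤ n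
quotient-≤ β m n r s r≤s lt = s≤s⁻¹ (*-cancelʳ-< β m (suc n) (+-cancelʳ-< s (m * β) (suc n * β) (begin-strict
  m * β + s       <⟨ lt ⟩
  n * β + r + β   ≤⟨ +-monoˡ-≤ β (+-monoʳ-≤ (n * β) r≤s) ⟩
  n * β + s + β   ≡⟨ +-comm (n * β + s) β ⟩
  β + (n * β + s) ≡⟨ +-assoc β (n * β) s ⟨
  suc n * β + s   ∎)))
  where open ≤-Reasoning

module Weighted {A : Set} (w : A → ℕ) where

  weight : List A → ℕ
  weight xs = sum (map w xs)

  weight-++ : ∀ xs ys → weight (xs ++ ys) ≡ weight xs + weight ys
  weight-++ xs ys = trans (cong sum (map-++ w xs ys)) (sum-++ (map w xs) (map w ys))

  weight-↭ : {xs ys : List A} → xs ↭ ys → weight xs ≡ weight ys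
  weight-↭ p = sum-↭ (map⁺ w p)

  weight≟ : ∀ β → Decidable (λ x → w x ≡ β)
  weight≟ β x = w x ≟ β

  weight-≤ : ∀ {c} xs → All (λ x → w x ≤ c) xs → weight xs ≤ length xs * c
  weight-≤ [] [] = z≤n
  weight-≤ (x ∷ xs) (wx≤c ∷ ws≤c) = +-mono-≤ wx≤c (weight-≤ xs ws≤c)

  weight-≡ : ∀ {c} xs → All (λ x → w x ≡ c) xs → weight xs ≡ length xs * c
  weight-≡ [] [] = refl
  weight-≡ (x ∷ xs) (wx≡c ∷ ws≡c) = cong₂ _+_ wx≡c (weight-≡ xs ws≡c)

  weight-take : ∀ {c} m xs → All (λ x → w x ≡ c) xs → m ≤ length xs → weight (take m xs) ≡ m * c
  weight-take {c} m xs ws≡c m≤ =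
    trans (weight-≡ (take m xs) (take⁺ m ws≡c)) (cong (_* c) (trans (length-take m xs) (m≤n⇒m⊓n≡m m≤)))

  ∣-weight-concat : ∀ {d} xss → All (λ xs → d ∣ weight xs) xss → d ∣ weight (concat xss)
  ∣-weight-concat [] [] = divides 0 refl
  ∣-weight-concat (xs ∷ xss) (d∣xs ∷ d∣xss) =
    subst (_ ∣_) (sym (weight-++ xs (concat xss))) (∣m∣n⇒∣m+n d∣xs (∣-weight-concat xss d∣xss))

  w≤maxL : ∀ xs → All (λ x → w x ≤ maxL (map w xs)) xs
  w≤maxL [] = []
  w≤maxL (x ∷ xs) = m≤m⊔n (w x) _ ∷ All.map (m≤n⇒m≤o⊔n (w x)) (w≤maxL xs)

  filter-map : ∀ {P : ℕ → Set} (P? : Decidable P) xs →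
    filter P? (map w xs) ≡ map w (filter (P? ∘ w) xs)
  filter-map P? [] = refl
  filter-map P? (x ∷ xs) with P? (w x)
  ... | yes _ = cong (w x ∷_) (filter-map P? xs)
  ... | no _ = filter-map P? xs

  DivisibleBlock : ℕ → List A → Set
  DivisibleBlock β ys = length ys ≤ β × β ∣ weight ys

  divisible-block : ∀ β .{{_ : NonZero β}} xs → β ≤ length xs →
    ∃₂ λ ys zs → xs ↭ ys ++ zs × 1 ≤ length ys × DivisibleBlock β ys
  divisible-block β xs β≤xs
    with i , j , i<j , j≤β , eq ← prefix-collision β (λ ys → weight ys % β) xs (λ i → m%n<n _ β) =
    slice i j xs , take i xs ++ drop j xs , ↭-sym (slice-↭ xs (<⇒≤ i<j)) ,
    subst (1 ≤_) (sym length≡) (m<n⇒0<n∸m i<j) ,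
    subst (_≤ β) (sym length≡) (≤-trans (m∸n≤m j i) j≤β) ,
    %-≡⇒∣ (weight (take i xs)) (weight (slice i j xs)) β (trans eq (cong (_% β) weight-take-j))
    where
    length≡ : length (slice i j xs) ≡ j ∸ i
    length≡ = length-slice i xs (≤-trans j≤β β≤xs)
    weight-take-j : weight (take j xs) ≡ weight (take i xs) + weight (slice i j xs)
    weight-take-j = trans (cong weight (take≡take++slice xs (<⇒≤ i<j))) (weight-++ (take i xs) _)

  divisible-blocks : ∀ β .{{_ : NonZero β}} xs →
    ∃₂ λ bss rest → xs ↭ concat bss ++ rest × All (DivisibleBlock β) bss × length rest < β
  divisible-blocks β xs = go (length xs) xs ≤-refl
    where
    go : ∀ n xs → length xs ≤ n →
      ∃₂ λ bss rest → xs ↭ concat bss ++ rest × All (DivisibleBlock β) bss × length rest < β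
    go n xs _ with length xs <? β
    ... | yes short = [] , xs , ↭-refl , [] , short
    go zero xs xs≤0 | no long = contradiction (≤-<-trans xs≤0 (>-nonZero⁻¹ β)) long
    go (suc n) xs xs≤n+1 | no long
      with ys , zs , xs↭ys++zs , 1≤ys , block ← divisible-block β xs (≮⇒≥ long)
      with bss , rest , zs↭ , blocks , short ← go n zs (s≤s⁻¹ (≤-trans (↭-++-length< {ys = ys} xs↭ys++zs 1≤ys) xs≤n+1))
      = ys ∷ bss , rest , ↭-trans xs↭ys++zs (↭-trans (++⁺ˡ ys zs↭) (↭-reflexive (sym (++-assoc ys (concat bss) rest)))) ,
        block ∷ blocks , short

  BoundedMultiple : ℕ → ℕ → List A → Set
  BoundedMultiple β α ys = ∃ λ q → weight ys ≡ q * β × q ≤ α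

  block-bounded : ∀ β .{{_ : NonZero β}} {α} ys → DivisibleBlock β ys → All (λ y → w y ≤ α) ys →
    BoundedMultiple β α ys
  block-bounded β {α} ys (ys≤β , divides q wys≡qβ) ys≤α = q , wys≡qβ , *-cancelʳ-≤ q α β (begin
    q * β          ≡⟨ wys≡qβ ⟨
    weight ys      ≤⟨ weight-≤ ys ys≤α ⟩
    length ys * α  ≤⟨ *-monoˡ-≤ α ys≤β ⟩
    β * α          ≡⟨ *-comm β α ⟩
    α * β          ∎)
    where open ≤-Reasoning

  exact-subsum : ∀ β .{{_ : NonZero β}} α m bss B →
    All (BoundedMultiple β α) bss → All (λ x → w x ≡ β) B → α ∸ 1 ≤ length B →
    m * β ≤ weight (concat bss) + length B * β →
    ∃ λ G → G ⊆ₘ concat bss ++ B × weight G ≡ m * β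
  exact-subsum β α m [] B [] B≡β _ mβ≤ =
    take m B , (drop m B , ↭-reflexive (take++drop≡id m B)) ,
    weight-take m B B≡β (*-cancelʳ-≤ m (length B) β mβ≤)
  exact-subsum β α m (ys ∷ bss) B ((q , wys≡qβ , q≤α) ∷ mults) B≡β α-1≤B mβ≤ with q ≤? m
  ... | no q≰m =
    take m B , (drop m B ++ concat (ys ∷ bss) , take-from-B) ,
    weight-take m B B≡β (≤-trans (<⇒≤pred (<-≤-trans (≰⇒> q≰m) q≤α)) α-1≤B)
    where
    take-from-B : take m B ++ drop m B ++ concat (ys ∷ bss) ↭ concat (ys ∷ bss) ++ B
    take-from-B = begin
      take m B ++ drop m B ++ concat (ys ∷ bss)    ≡⟨ ++-assoc (take m B) _ _ ⟨
      (take m B ++ drop m B) ++ concat (ys ∷ bss)  ≡⟨ cong (_++ concat (ys ∷ bss)) (take++drop≡id m B) ⟩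
      B ++ concat (ys ∷ bss)                       ↭⟨ ++-comm B _ ⟩
      concat (ys ∷ bss) ++ B                       ∎
      where open PermutationReasoning
  ... | yes q≤m = prepend-ys (exact-subsum β α (m ∸ q) bss B mults B≡β α-1≤B rest-bound)
    where
    prepend-ys : (∃ λ G → G ⊆ₘ concat bss ++ B × weight G ≡ (m ∸ q) * β) →
                 ∃ λ G → G ⊆ₘ concat (ys ∷ bss) ++ B × weight G ≡ m * β
    prepend-ys (G , (H , G++H↭) , wG) = ys ++ G ,
      (H , ↭-trans (↭-reflexive (++-assoc ys G H))
                   (↭-trans (++⁺ˡ ys G++H↭) (↭-reflexive (sym (++-assoc ys _ B))))) ,
      (begin
        weight (ys ++ G)        ≡⟨ weight-++ ys G ⟩
        weight ys + weight G    ≡⟨ cong₂ _+_ wys≡qβ wG ⟩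
        q * β + (m ∸ q) * β     ≡⟨ *-distribʳ-+ β q (m ∸ q) ⟨
        (q + (m ∸ q)) * β       ≡⟨ cong (_* β) (m+[n∸m]≡n q≤m) ⟩
        m * β                   ∎)
      where open ≡-Reasoning
    rest-bound : (m ∸ q) * β ≤ weight (concat bss) + length B * β
    rest-bound = ≤-trans (≤-reflexive (*-distribʳ-∸ β m q)) (m≤n+o⇒m∸n≤o (m * β) (q * β) (begin
      m * β                                          ≤⟨ mβ≤ ⟩
      weight (ys ++ concat bss) + length B * β       ≡⟨ cong (_+ length B * β) (weight-++ ys _) ⟩
      weight ys + weight (concat bss) + length B * β ≡⟨ cong (λ x → x + weight (concat bss) + length B * β) wys≡qβ ⟩
      q * β + weight (concat bss) + length B * β     ≡⟨ +-assoc (q * β) _ _ ⟩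
      q * β + (weight (concat bss) + length B * β)   ∎))
      where open ≤-Reasoning

  record Decomposition (β : ℕ) (xs : List A) : Set where
    field
      blocks        : List (List A)
      βs         : List A
      rest          : List A
      split         : (concat blocks ++ βs) ++ rest ↭ xs
      blocks-bounded : All (BoundedMultiple β (maxL (map w xs))) blocks
      βs-weight  : All (λ x → w x ≡ β) βs
      βs-count   : length βs ≡ countL β (map w xs)
      rest-short    : length rest < β
      rest-bounded  : All (λ x → w x ≤ maxL (removeL β (map w xs))) rest

  decompose : ∀ β .{{_ : NonZero β}} xs → Decomposition β xs
  decompose β xs
    with blocks , rest , others↭ , divisible , short ← divisible-blocks β (filter (¬? ∘ weight≟ β) xs) = record
      { blocks = blocks ; βs = βs ; rest = rest ; split = split
      ; blocks-bounded = All.zipWith (λ (d , b) → block-bounded β _ d b) (divisible , concat⁻ (++⁻ˡ (concat blocks) blocks++rest≤α))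
      ; βs-weight = all-filter (weight≟ β) xs
      ; βs-count = sym (trans (cong length (filter-map (_≟ β) xs)) (length-map w βs))
      ; rest-short = short
      ; rest-bounded = subst (λ ws → All (λ x → w x ≤ maxL ws) rest) (sym (filter-map (¬? ∘ (_≟ β)) xs))
                             (++⁻ʳ (concat blocks) (All-resp-↭ others↭ (w≤maxL others)))
      }
    where
    βs others : List A
    βs = filter (weight≟ β) xs
    others = filter (¬? ∘ weight≟ β) xs
    blocks++rest≤α : All (λ x → w x ≤ maxL (map w xs)) (concat blocks ++ rest)
    blocks++rest≤α = All-resp-↭ others↭ (filter⁺ (¬? ∘ weight≟ β) (w≤maxL xs))
    split : (concat blocks ++ βs) ++ rest ↭ xs
    split = begin
      (concat blocks ++ βs) ++ rest  ≡⟨ ++-assoc (concat blocks) βs rest ⟩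
      concat blocks ++ βs ++ rest    ↭⟨ shifts (concat blocks) βs ⟩
      βs ++ concat blocks ++ rest    ↭⟨ ++⁺ˡ βs others↭ ⟨
      βs ++ others                   ↭⟨ filter-partition-↭ (weight≟ β) xs ⟨
      xs                                ∎
      where open PermutationReasoning

  subsum-or-bound : ∀ β .{{_ : NonZero β}} m xs →
    maxL (map w xs) ∸ 1 ≤ countL β (map w xs) →
    weight xs + β ≤ m * β + (β ∸ 1) * maxL (removeL β (map w xs)) ⊎
    ∃ λ G → G ⊆ₘ xs × weight G ≡ m * β
  subsum-or-bound β m xs enough-βs
    with weight xs + β ≤? m * β + (β ∸ 1) * maxL (removeL β (map w xs))
  ... | yes bound = inj₁ bound
  ... | no ¬bound =
    let G , G⊆ , wG = exact-subsum β α m blocks βs blocks-bounded βs-weight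
                        (subst (α ∸ 1 ≤_) (sym βs-count) enough-βs) target≤
    in inj₂ (G , ⊆ₘ-trans G⊆ (rest , split) , wG)
    where
    open Decomposition (decompose β xs)
    α = maxL (map w xs)
    M = maxL (removeL β (map w xs))
    open _∣_ (∣-weight-concat blocks (All.map (λ (q , e , _) → divides q e) blocks-bounded))
      renaming (quotient to Q; equality to weight-blocks)
    weight-xs : weight xs ≡ (Q + length βs) * β + weight rest
    weight-xs = begin
      weight xs                                          ≡⟨ weight-↭ split ⟨
      weight ((concat blocks ++ βs) ++ rest)          ≡⟨ weight-++ (concat blocks ++ βs) rest ⟩
      weight (concat blocks ++ βs) + weight rest      ≡⟨ cong (_+ weight rest) (weight-++ (concat blocks) βs) ⟩
      weight (concat blocks) + weight βs + weight rest
        ≡⟨ cong (_+ weight rest) (cong₂ _+_ weight-blocks (weight-≡ βs βs-weight)) ⟩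
      Q * β + length βs * β + weight rest             ≡⟨ cong (_+ weight rest) (*-distribʳ-+ β Q (length βs)) ⟨
      (Q + length βs) * β + weight rest               ∎
      where open ≡-Reasoning
    rest≤ : weight rest ≤ (β ∸ 1) * M
    rest≤ = ≤-trans (weight-≤ rest rest-bounded) (*-monoˡ-≤ M (<⇒≤pred rest-short))
    m≤Q+|βs| : m ≤ Q + length βs
    m≤Q+|βs| = quotient-≤ β m (Q + length βs) (weight rest) ((β ∸ 1) * M) rest≤
      (subst (λ x → m * β + (β ∸ 1) * M < x + β) weight-xs (≰⇒> ¬bound))
    target≤ : m * β ≤ weight (concat blocks) + length βs * β
    target≤ = begin
      m * β                      ≤⟨ *-monoˡ-≤ β m≤Q+|βs| ⟩
      (Q + length βs) * β     ≡⟨ *-distribʳ-+ β Q (length βs) ⟩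
      Q * β + length βs * β   ≡⟨ cong (_+ length βs * β) weight-blocks ⟨
      weight (concat blocks) + length βs * β ∎
      where open ≤-Reasoning

sumℤ-++ : ∀ xs ys → sumℤ (xs ++ ys) ≡ sumℤ xs +ℤ sumℤ ys
sumℤ-++ [] ys = sym (ℤₚ.+-identityˡ _)
sumℤ-++ (x ∷ xs) ys = trans (cong (x +ℤ_) (sumℤ-++ xs ys)) (sym (ℤₚ.+-assoc x _ _))

sumℤ-↭ : {xs ys : List ℤ} → xs ↭ ys → sumℤ xs ≡ sumℤ ys
sumℤ-↭ p = ↭ₛ.foldr-commMonoid (setoid ℤ) ℤₚ.+-0-isCommutativeMonoid (↭⇒↭ₛ p)

sumℤ-nonneg : {xs : List ℤ} → All (0ℤ ≤ℤ_) xs → 0ℤ ≤ℤ sumℤ xs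
sumℤ-nonneg = foldr-preservesᵇ ℤₚ.+-mono-≤ ℤₚ.≤-refl

sumℤ-nonpos : {xs : List ℤ} → All (_≤ℤ 0ℤ) xs → sumℤ xs ≤ℤ 0ℤ
sumℤ-nonpos = foldr-preservesᵇ ℤₚ.+-mono-≤ ℤₚ.≤-refl

sumℤ-neg : ∀ {x xs} → All (_<ℤ 0ℤ) (x ∷ xs) → sumℤ (x ∷ xs) <ℤ 0ℤ
sumℤ-neg (x<0 ∷ xs<0) = ℤₚ.+-mono-<-≤ x<0 (sumℤ-nonpos (All.map ℤₚ.<⇒≤ xs<0))

sumℤ-∷⁻ : ∀ {xs y ys s} → xs ↭ y ∷ ys → sumℤ xs ≡ - s → sumℤ ys ≡ - (s +ℤ y)
sumℤ-∷⁻ {xs} {y} {ys} {s} xs↭ Σxs≡-s = begin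
  sumℤ ys                ≡⟨ ℤₚ.+-identityˡ _ ⟨
  0ℤ +ℤ sumℤ ys          ≡⟨ cong (_+ℤ sumℤ ys) (ℤₚ.+-inverseˡ y) ⟨
  (- y +ℤ y) +ℤ sumℤ ys  ≡⟨ ℤₚ.+-assoc (- y) y (sumℤ ys) ⟩
  - y +ℤ sumℤ (y ∷ ys)   ≡⟨ cong (- y +ℤ_) (trans (sym (sumℤ-↭ xs↭)) Σxs≡-s) ⟩
  - y +ℤ - s             ≡⟨ ℤₚ.+-comm (- y) (- s) ⟩
  - s +ℤ - y             ≡⟨ ℤₚ.neg-distrib-+ s y ⟨
  - (s +ℤ y)             ∎
  where open ≡-Reasoning

zero-sum-concat : ∀ xss → All ZeroSum xss → ZeroSum (concat xss)
zero-sum-concat [] [] = refl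
zero-sum-concat (xs ∷ xss) (Σxs≡0 ∷ Σxss≡0) =
  trans (sumℤ-++ xs (concat xss)) (cong₂ _+ℤ_ Σxs≡0 (zero-sum-concat xss Σxss≡0))

-- Terms lie in [−(a + 1), b] ∖ {0}.  Adding a positive term at a partial sum ≤ 0 and a negative one
-- at a partial sum > 0 keeps every partial sum in the window [−a, b] of a + b + 1 integers.
module Walk (a b : ℕ) where

  Step : ℤ → Set
  Step x = -[1+ a ] ≤ℤ x × x ≤ℤ + b × x ≢ 0ℤ

  InWindow : ℤ → Set
  InWindow s = - (+ a) ≤ℤ s × s ≤ℤ + b

  StaysInWindow : ℤ → List ℤ → Set
  StaysInWindow s xs = ∀ i → InWindow (s +ℤ sumℤ (take i xs))

  0-in-window : InWindow 0ℤ
  0-in-window = ℤₚ.neg-mono-≤ (+≤+ z≤n) , +≤+ z≤n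

  stays-[] : ∀ {s} → InWindow s → StaysInWindow s []
  stays-[] {s} s∈ zero = subst InWindow (sym (ℤₚ.+-identityʳ s)) s∈
  stays-[] {s} s∈ (suc i) = subst InWindow (sym (ℤₚ.+-identityʳ s)) s∈

  stays-∷ : ∀ {s x xs} → InWindow s → StaysInWindow (s +ℤ x) xs → StaysInWindow s (x ∷ xs)
  stays-∷ {s} s∈ _ zero = subst InWindow (sym (ℤₚ.+-identityʳ s)) s∈
  stays-∷ {s} {x} {xs} _ stays (suc i) = subst InWindow (ℤₚ.+-assoc s x (sumℤ (take i xs))) (stays i)

  step-up : ∀ {s x} → InWindow s → s ≤ℤ 0ℤ → 0ℤ <ℤ x → Step x → InWindow (s +ℤ x)
  step-up {s} {x} (-a≤s , _) s≤0 0<x (_ , x≤b , _) =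
    ℤₚ.≤-trans -a≤s (ℤₚ.≤-trans (ℤₚ.≤-reflexive (sym (ℤₚ.+-identityʳ s))) (ℤₚ.+-monoʳ-≤ s (ℤₚ.<⇒≤ 0<x))) ,
    ℤₚ.≤-trans (ℤₚ.+-monoˡ-≤ x s≤0) (ℤₚ.≤-trans (ℤₚ.≤-reflexive (ℤₚ.+-identityˡ x)) x≤b)

  step-down : ∀ {s x} → InWindow s → 0ℤ <ℤ s → x <ℤ 0ℤ → Step x → InWindow (s +ℤ x)
  step-down {s} {x} (_ , s≤b) 0<s x<0 (-a-1≤x , _ , _) =
    subst (_≤ℤ s +ℤ x) (ℤₚ.1-[1+n]≡-n a) (ℤₚ.i<j⇒suc[i]≤j {i = -[1+ a ]} (subst₂ _<ℤ_ (ℤₚ.+-identityʳ -[1+ a ]) (ℤₚ.+-comm x s) (ℤₚ.+-mono-≤-< -a-1≤x 0<s))) ,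
    ℤₚ.≤-trans (ℤₚ.+-monoʳ-≤ s (ℤₚ.<⇒≤ x<0)) (ℤₚ.≤-trans (ℤₚ.≤-reflexive (ℤₚ.+-identityʳ s)) s≤b)

  positive-in : ∀ {x xs} → All Step (x ∷ xs) → 0ℤ ≤ℤ sumℤ (x ∷ xs) → Any (0ℤ <ℤ_) (x ∷ xs)
  positive-in {x} {xs} steps 0≤Σ with any? (0ℤ <ℤ?_) (x ∷ xs)
  ... | yes some-positive = some-positive
  ... | no none-positive = contradiction 0≤Σ (ℤₚ.<⇒≱ (sumℤ-neg (All.zipWith negative (steps , ¬Any⇒All¬ _ none-positive))))
    where
    negative : ∀ {y} → Step y × ¬ 0ℤ <ℤ y → y <ℤ 0ℤ
    negative ((_ , _ , y≢0) , ¬0<y) = ℤₚ.≤∧≢⇒< (ℤₚ.≮⇒≥ ¬0<y) y≢0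

  negative-in : ∀ {xs} → sumℤ xs <ℤ 0ℤ → Any (_<ℤ 0ℤ) xs
  negative-in {xs} Σ<0 with any? (_<ℤ? 0ℤ) xs
  ... | yes some-negative = some-negative
  ... | no none-negative = contradiction Σ<0 (ℤₚ.≤⇒≯ (sumℤ-nonneg (All.map ℤₚ.≮⇒≥ (¬Any⇒All¬ _ none-negative))))

  next-step : ∀ {s x xs} → All Step (x ∷ xs) → InWindow s → sumℤ (x ∷ xs) ≡ - s →
    ∃ λ y → y ∈ x ∷ xs × InWindow (s +ℤ y)
  next-step {s} steps s∈ Σ≡-s with s ≤ℤ? 0ℤ
  ... | yes s≤0 =
    let y , y∈ , 0<y = find (positive-in steps (subst (0ℤ ≤ℤ_) (sym Σ≡-s) (ℤₚ.neg-mono-≤ s≤0)))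
    in y , y∈ , step-up s∈ s≤0 0<y (All.lookup steps y∈)
  ... | no s≰0 =
    let y , y∈ , y<0 = find (negative-in (subst (_<ℤ 0ℤ) (sym Σ≡-s) (ℤₚ.neg-mono-< (ℤₚ.≰⇒> s≰0))))
    in y , y∈ , step-down s∈ (ℤₚ.≰⇒> s≰0) y<0 (All.lookup steps y∈)

  reorder : ∀ n s xs → length xs ≡ n → All Step xs → InWindow s → sumℤ xs ≡ - s →
    ∃ λ ys → ys ↭ xs × StaysInWindow s ys
  reorder zero s [] _ _ s∈ _ = [] , ↭-refl , stays-[] s∈
  reorder (suc n) s (x ∷ xs) len steps s∈ Σ≡-s
    with y , y∈ , s+y∈ ← next-step steps s∈ Σ≡-s
    with rest , ↭y∷rest ← ∈⇒↭∷ y∈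
    with ys , ys↭rest , stays ← reorder n (s +ℤ y) rest (suc-injective (trans (sym (↭-length ↭y∷rest)) len))
                                   (All.tail (All-resp-↭ ↭y∷rest steps)) s+y∈ (sumℤ-∷⁻ ↭y∷rest Σ≡-s)
    = y ∷ ys , ↭-trans (↭-prep y ys↭rest) (↭-sym ↭y∷rest) , stays-∷ s∈ stays

  offset : ℤ → ℕ
  offset z = ∣ + a +ℤ z ∣

  +-offset : ∀ {z} → InWindow z → + offset z ≡ + a +ℤ z
  +-offset {z} (-a≤z , _) =
    ℤₚ.0≤i⇒+∣i∣≡i (subst (_≤ℤ + a +ℤ z) (ℤₚ.+-inverseʳ (+ a)) (ℤₚ.+-monoʳ-≤ (+ a) -a≤z))

  offset-< : ∀ {z} → InWindow z → offset z < suc (a + b)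
  offset-< {z} z∈@(_ , z≤b) =
    s≤s (ℤₚ.drop‿+≤+ (subst (_≤ℤ + (a + b)) (sym (+-offset z∈)) (ℤₚ.+-monoʳ-≤ (+ a) z≤b)))

  offset-injective : ∀ {z z′} → InWindow z → InWindow z′ → offset z ≡ offset z′ → z ≡ z′
  offset-injective z∈ z′∈ eq = ∙-cancelˡ (+ a) _ _ (trans (sym (+-offset z∈)) (trans (cong +_ eq) (+-offset z′∈)))

  minimal-length≤ : ∀ xs → All Step xs → MinimalZeroSum xs → length xs ≤ suc (a + b)
  minimal-length≤ xs steps (_ , Σxs≡0 , minimal) with length xs ≤? suc (a + b)
  ... | yes short = short
  ... | no long
    with ys , ys↭xs , stays ← reorder _ 0ℤ xs refl steps 0-in-window Σxs≡0
    with i , j , i<j , j≤ , eq ← prefix-collision (suc (a + b)) (λ zs → offset (0ℤ +ℤ sumℤ zs)) ys (λ i → offset-< (stays i))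
    = subst (_≤ suc (a + b)) (minimal T T⊆xs T≢[] ΣT≡0) (subst (_≤ suc (a + b)) (sym length-T) (≤-trans (m∸n≤m j i) j≤))
    where
    T = slice i j ys
    length-T : length T ≡ j ∸ i
    length-T = length-slice i ys (≤-trans j≤ (≤-trans (<⇒≤ (≰⇒> long)) (≤-reflexive (sym (↭-length ys↭xs)))))
    T⊆xs : T ⊆ₘ xs
    T⊆xs = take i ys ++ drop j ys , ↭-trans (slice-↭ ys (<⇒≤ i<j)) ys↭xs
    T≢[] : T ≢ []
    T≢[] T≡[] = <⇒≢ (m<n⇒0<n∸m i<j) (trans (sym (cong length T≡[])) length-T)
    Σi≡Σj : sumℤ (take i ys) ≡ sumℤ (take j ys)
    Σi≡Σj = ∙-cancelˡ 0ℤ _ _ (offset-injective (stays i) (stays j) eq)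
    ΣT≡0 : ZeroSum T
    ΣT≡0 = ∙-cancelˡ (sumℤ (take i ys)) _ _ (begin
      sumℤ (take i ys) +ℤ sumℤ T  ≡⟨ sumℤ-++ (take i ys) T ⟨
      sumℤ (take i ys ++ T)       ≡⟨ cong sumℤ (take≡take++slice ys (<⇒≤ i<j)) ⟨
      sumℤ (take j ys)            ≡⟨ Σi≡Σj ⟨
      sumℤ (take i ys)            ≡⟨ ℤₚ.+-identityʳ _ ⟨
      sumℤ (take i ys) +ℤ 0ℤ      ∎)
      where open ≡-Reasoning

minimal-length≤2k∸1 : ∀ k → 2 ≤ k → ∀ U → OverIk k U → MinimalZeroSum U → length U ≤ 2 * k ∸ 1
minimal-length≤2k∸1 (suc zero) (s≤s ()) _ _ _
minimal-length≤2k∸1 (suc (suc n)) _ U over mzs@(_ , _ , minimal)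
  with 0ℤ ∈? U | + suc (suc n) ∈? U | -[1+ suc n ] ∈? U
... | yes 0∈U | _ | _ =
  subst (_≤ 2 * suc (suc n) ∸ 1) (minimal _ (singleton-⊆ₘ 0∈U) (λ ()) refl) (s≤s z≤n)
... | no _ | yes k∈U | yes -k∈U =
  subst (_≤ 2 * suc (suc n) ∸ 1) (minimal _ (pair-⊆ₘ k∈U -k∈U (λ ())) (λ ()) k-k≡0)
        (s≤s (≤-trans (s≤s z≤n) (m≤n+m _ n)))
  where
  k-k≡0 : + suc (suc n) +ℤ (-[1+ suc n ] +ℤ 0ℤ) ≡ 0ℤ
  k-k≡0 = trans (cong (+ suc (suc n) +ℤ_) (ℤₚ.+-identityʳ -[1+ suc n ])) (ℤₚ.+-inverseʳ (+ suc (suc n)))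
... | no 0∉U | no k∉U | _ =
  subst (length U ≤_) bound-eq (Walk.minimal-length≤ (suc n) (suc n) U (All.tabulate step) mzs)
  where
  step : ∀ {x} → x ∈ U → Walk.Step (suc n) (suc n) x
  step {x} x∈U =
    proj₁ (All.lookup over x∈U) ,
    ℤₚ.i<j⇒i≤pred[j] (ℤₚ.≤∧≢⇒< (proj₂ (All.lookup over x∈U)) (λ x≡k → k∉U (subst (_∈ U) x≡k x∈U))) ,
    λ x≡0 → 0∉U (subst (_∈ U) x≡0 x∈U)
  bound-eq : suc (suc n + suc n) ≡ 2 * suc (suc n) ∸ 1
  bound-eq = cong suc (trans (cong (λ m → suc (n + suc m)) (sym (+-identityʳ n))) (sym (+-suc n _)))
... | no 0∉U | yes _ | no -k∉U =
  subst (length U ≤_) bound-eq (Walk.minimal-length≤ n (suc (suc n)) U (All.tabulate step) mzs)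
  where
  step : ∀ {x} → x ∈ U → Walk.Step n (suc (suc n)) x
  step {x} x∈U =
    ℤₚ.i<j⇒suc[i]≤j (ℤₚ.≤∧≢⇒< (proj₁ (All.lookup over x∈U)) (λ -k≡x → -k∉U (subst (_∈ U) (sym -k≡x) x∈U))) ,
    proj₂ (All.lookup over x∈U) ,
    λ x≡0 → 0∉U (subst (_∈ U) x≡0 x∈U)
  bound-eq : suc (n + suc (suc n)) ≡ 2 * suc (suc n) ∸ 1
  bound-eq = cong (λ m → suc (n + suc (suc m))) (sym (+-identityʳ n))

factor-length-bounds : ∀ k → 2 ≤ k → ∀ {S Fs} → OverIk k S → Factorization S Fs →
  ∀ {ℓ} → ℓ ∈ map length Fs → 1 ≤ ℓ × ℓ ≤ 2 * k ∸ 1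
factor-length-bounds k 2≤k over (concat↭S , minimal-Fs) ℓ∈ with U , U∈Fs , refl ← ∈-map⁻ length ℓ∈ =
  nonempty (proj₁ U-minimal) ,
  minimal-length≤2k∸1 k 2≤k U (All.lookup (concat⁻ (All-resp-↭ (↭-sym concat↭S) over)) U∈Fs) U-minimal
  where
  U-minimal = All.lookup minimal-Fs U∈Fs
  nonempty : ∀ {xs : Seq} → xs ≢ [] → 1 ≤ length xs
  nonempty {[]} []≢[] = contradiction refl []≢[]
  nonempty {_ ∷ _} _ = s≤s z≤n

lemma3p7 : (k t : ℕ) → 2 ≤ k → 1 ≤ t →
    (∀ i → 1 ≤ i → i ≤ 2 * k ∸ 1 → i ∣ t) →
    (S : Seq) → OverIk k S → ZeroSum S →
    t + k * (k ∸ 1) ≤ length S →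
    (∀ T → SubSeq T S → length T ≡ t → ¬ ZeroSum T) →
    (Fs : List Seq) → Factorization S Fs →
    (β : ℕ) → β ∈ map length Fs →
    maxL (map length Fs) ∸ 1 ≤ countL β (map length Fs) →
    length S + β ≤ t + (β ∸ 1) * maxL (removeL β (map length Fs))
lemma3p7 k t 2≤k _ small∣t S over _ _ no-zero-sum-of-length-t Fs fact@(concat↭S , minimal-Fs) β β∈ enough-β
  with 1≤β , β≤2k-1 ← factor-length-bounds k 2≤k over fact β∈
  with divides m t≡mβ ← small∣t β 1≤β β≤2k-1
  with Weighted.subsum-or-bound length β {{>-nonZero 1≤β}} m Fs enough-β
... | inj₁ bound = subst₂ (λ s t → s + β ≤ t + _) length-S (sym t≡mβ) bound
  where
  length-S : sum (map length Fs) ≡ length S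
  length-S = trans (sym (length-concat Fs)) (↭-length concat↭S)
... | inj₂ (G , G⊆Fs , length-G≡mβ) =
  contradiction (zero-sum-concat G (All.map (λ (_ , zero-sum , _) → zero-sum) (All-⊆ₘ G⊆Fs minimal-Fs)))
    (no-zero-sum-of-length-t (concat G) (⊆ₘ-respʳ-↭ (concat-⊆ₘ G⊆Fs) concat↭S)
      (trans (length-concat G) (trans length-G≡mβ (sym t≡mβ))))
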